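{- For all $\ell,n\in\mathbb N$: (i) $$s_\ell(n)=\frac12\binom{n+1}{\ell+1}+\frac14\sum_{i=0}^{\ell-1}\left(\frac{ -1}{2}\right)^i\binom{n+1}{\ell-i}+\begin{cases}\frac{(-1)^\ell}{2^{\ell+1}}&\text{if $n$ is even},\\0&\text{if $n$ is odd};\end{cases}$$ (ii) writing $T_\ell(n)=\frac12\binom{n+1}{\ell+1}+\frac14\sum_{i=0}^{\ell-1}\left(\frac{ -1}{2}\right)^i\binom{n+1}{\ell-i}$, we have $s_\ell(n)=\lceil T_\ell(n)\rceil$ if $\ell$ is even and $s_\ell(n)=\lfloor T_\ell(n)\rfloor$ if $\ell$ is odd.
   Context: For $\ell,n\in\mathbb N$, $\binom n\ell=\prod_{i=1}^{\ell}\frac{n-i+1}{\ell-i+1}$, and $s_\ell(n)=\sum_{i=0}^{\lfloor n/2\rfloor}\binom{n-2i}{\ell}$. A vacuous sum is $0$. -}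

module Defs where

open import Data.Nat as ℕ using (ℕ; zero; suc)
open import Data.Nat.Combinatorics using (_C_)
open import Data.Integer as ℤ using (ℤ)
open import Data.Rational as ℚ using (ℚ; 0ℚ; 1ℚ; _+_; _*_; -_; _/_)

sumℕ : ℕ → (ℕ → ℕ) → ℕ
sumℕ zero    f = 0
sumℕ (suc m) f = sumℕ m f ℕ.+ f m

sumℚ : ℕ → (ℕ → ℚ) → ℚ
sumℚ zero    f = 0ℚ
sumℚ (suc m) f = sumℚ m f + f m

_^ℚ_ : ℚ → ℕ → ℚ
q ^ℚ zero  = 1ℚ
q ^ℚ suc k = q * (q ^ℚ k)

ℕ→ℚ : ℕ → ℚ
ℕ→ℚ n = ℤ.+ n / 1

s : ℕ → ℕ → ℕ
s ℓ n = sumℕ (suc (n ℕ./ 2)) (λ i → (n ℕ.∸ 2 ℕ.* i) C ℓ)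

T : ℕ → ℕ → ℚ
T ℓ n = (ℤ.+ 1 / 2) * ℕ→ℚ (suc n C suc ℓ)
      + (ℤ.+ 1 / 4) * sumℚ ℓ (λ i → ((ℤ.- ℤ.+ 1) / 2) ^ℚ i * ℕ→ℚ (suc n C (ℓ ℕ.∸ i)))

corr : ℕ → ℕ → ℚ
corr ℓ n with n ℕ.% 2
... | zero  = ((ℤ.- ℤ.+ 1) / 1) ^ℚ ℓ * ((ℤ.+ 1 / 2) ^ℚ suc ℓ)
... | suc _ = 0ℚ

-- Peeling off the first term of s_ℓ(n + 2) gives s_ℓ(n + 2) = C(n+2, ℓ) + s_ℓ(n), and
-- together with Pascal's rule this yields 2 s_{ℓ+1}(n) + s_ℓ(n) = C(n+2, ℓ+2), i.e.
-- s_{ℓ+1}(n) = ½ (C(n+1, ℓ+1) + C(n+1, ℓ+2) − s_ℓ(n)).  Both sides of (i) satisfy this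
-- recursion in ℓ (the alternating sum in T and the correction term each pick up a factor −½),
-- and they agree for ℓ = 0, so (i) holds.  The correction term (−½)^ℓ/2 or 0 lies in [0, 1)
-- for even ℓ and in (−1, 0] for odd ℓ, so the integer s_ℓ(n) is the ceiling resp. floor of T_ℓ(n).
module Submission where

open import Defs
open import Data.Nat as ℕ using (ℕ; zero; suc; _%_; z≤n; s≤s)
import Data.Nat.Properties as ℕ
open import Data.Nat.DivMod using (m/n≡1+[m∸n]/n)
open import Data.Nat.Combinatorics using (_C_; nC1≡n; nCk+nC[k+1]≡[n+1]C[k+1])
open import Data.Nat.Tactic.RingSolver using (solve-∀)
open import Data.Integer as ℤ using (ℤ; +_)
import Data.Integer.Properties as ℤ
open import Data.Integer.DivMod using (_/ℕ_; div-pos-is-/ℕ; [n/ℕd]*d≤n; n<s[n/ℕd]*d)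
open import Data.Rational as ℚ
  using (ℚ; mkℚ; 0ℚ; 1ℚ; ½; -½; _+_; _*_; -_; _-_; _/_; _≤_; _<_; *≤*; *<*; floor; ceiling; nonNegative)
import Data.Rational.Properties as ℚ
open import Data.Rational.Literals using (fromℤ)
open import Data.Rational.Solver using (module +-*-Solver)
open +-*-Solver using (solve; _:+_; _:*_; :-_; _:=_; con)
import Data.Nat.Coprimality as Coprime
open import Data.Product using (_×_; _,_)
open import Relation.Binary.PropositionalEquality
open import Relation.Nullary.Decidable using (from-yes)
open ≡-Reasoning

sumℕ-cong : ∀ m {f g : ℕ → ℕ} → (∀ i → f i ≡ g i) → sumℕ m f ≡ sumℕ m g
sumℕ-cong zero    f≗g = refl
sumℕ-cong (suc m) f≗g = cong₂ ℕ._+_ (sumℕ-cong m f≗g) (f≗g m)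

sumℕ-suc : ∀ m (f : ℕ → ℕ) → sumℕ (suc m) f ≡ f 0 ℕ.+ sumℕ m (λ i → f (suc i))
sumℕ-suc zero    f = ℕ.+-comm 0 (f 0)
sumℕ-suc (suc m) f = begin
  sumℕ (suc m) f ℕ.+ f (suc m)                      ≡⟨ cong (ℕ._+ f (suc m)) (sumℕ-suc m f) ⟩
  f 0 ℕ.+ sumℕ m (λ i → f (suc i)) ℕ.+ f (suc m)    ≡⟨ ℕ.+-assoc (f 0) _ _ ⟩
  f 0 ℕ.+ sumℕ (suc m) (λ i → f (suc i))            ∎

nCk+2nC[k+1]+nC[k+2]≡[n+2]C[k+2] : ∀ n k →
  n C k ℕ.+ 2 ℕ.* (n C suc k) ℕ.+ n C suc (suc k) ≡ suc (suc n) C suc (suc k)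
nCk+2nC[k+1]+nC[k+2]≡[n+2]C[k+2] n k = begin
  a ℕ.+ 2 ℕ.* b ℕ.+ c          ≡⟨ regroup a b c ⟩
  (a ℕ.+ b) ℕ.+ (b ℕ.+ c)      ≡⟨ cong₂ ℕ._+_ (nCk+nC[k+1]≡[n+1]C[k+1] n k) (nCk+nC[k+1]≡[n+1]C[k+1] n (suc k)) ⟩
  suc n C suc k ℕ.+ suc n C suc (suc k) ≡⟨ nCk+nC[k+1]≡[n+1]C[k+1] (suc n) (suc k) ⟩
  suc (suc n) C suc (suc k)    ∎
  where
  a = n C k; b = n C suc k; c = n C suc (suc k)
  regroup : ∀ a b c → a ℕ.+ 2 ℕ.* b ℕ.+ c ≡ (a ℕ.+ b) ℕ.+ (b ℕ.+ c)
  regroup = solve-∀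

s-suc-suc : ∀ ℓ n → s ℓ (suc (suc n)) ≡ suc (suc n) C ℓ ℕ.+ s ℓ n
s-suc-suc ℓ n = begin
  sumℕ (suc (suc (suc n) ℕ./ 2)) term                   ≡⟨ cong (λ k → sumℕ (suc k) term) (m/n≡1+[m∸n]/n {suc (suc n)} (s≤s (s≤s z≤n))) ⟩
  sumℕ (suc (suc (n ℕ./ 2))) term                        ≡⟨ sumℕ-suc (suc (n ℕ./ 2)) term ⟩
  term 0 ℕ.+ sumℕ (suc (n ℕ./ 2)) (λ i → term (suc i))  ≡⟨ cong (term 0 ℕ.+_) (sumℕ-cong (suc (n ℕ./ 2)) drop-2) ⟩
  suc (suc n) C ℓ ℕ.+ s ℓ n                             ∎
  where
  term : ℕ → ℕ
  term i = (suc (suc n) ℕ.∸ 2 ℕ.* i) C ℓ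
  drop-2 : ∀ i → term (suc i) ≡ (n ℕ.∸ 2 ℕ.* i) C ℓ
  drop-2 i = cong (λ j → (suc (suc n) ℕ.∸ j) C ℓ) (ℕ.*-suc 2 i)

2s[ℓ+1]+s[ℓ]≡[n+2]C[ℓ+2] : ∀ ℓ n → 2 ℕ.* s (suc ℓ) n ℕ.+ s ℓ n ≡ suc (suc n) C suc (suc ℓ)
2s[ℓ+1]+s[ℓ]≡[n+2]C[ℓ+2] zero          zero          = refl
2s[ℓ+1]+s[ℓ]≡[n+2]C[ℓ+2] (suc ℓ)       zero          = refl
2s[ℓ+1]+s[ℓ]≡[n+2]C[ℓ+2] zero          (suc zero)    = refl
2s[ℓ+1]+s[ℓ]≡[n+2]C[ℓ+2] (suc zero)    (suc zero)    = refl
2s[ℓ+1]+s[ℓ]≡[n+2]C[ℓ+2] (suc (suc ℓ)) (suc zero)    = refl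
2s[ℓ+1]+s[ℓ]≡[n+2]C[ℓ+2] ℓ             (suc (suc n)) = begin
  2 ℕ.* s (suc ℓ) m ℕ.+ s ℓ m                 ≡⟨ cong₂ (λ x y → 2 ℕ.* x ℕ.+ y) (s-suc-suc (suc ℓ) n) (s-suc-suc ℓ n) ⟩
  2 ℕ.* (b ℕ.+ x) ℕ.+ (a ℕ.+ y)               ≡⟨ regroup a b x y ⟩
  a ℕ.+ 2 ℕ.* b ℕ.+ (2 ℕ.* x ℕ.+ y)           ≡⟨ cong (a ℕ.+ 2 ℕ.* b ℕ.+_) (2s[ℓ+1]+s[ℓ]≡[n+2]C[ℓ+2] ℓ n) ⟩
  a ℕ.+ 2 ℕ.* b ℕ.+ m C suc (suc ℓ)           ≡⟨ nCk+2nC[k+1]+nC[k+2]≡[n+2]C[k+2] m ℓ ⟩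
  suc (suc m) C suc (suc ℓ)                   ∎
  where
  m = suc (suc n); a = m C ℓ; b = m C suc ℓ; x = s (suc ℓ) n; y = s ℓ n
  regroup : ∀ a b x y → 2 ℕ.* (b ℕ.+ x) ℕ.+ (a ℕ.+ y) ≡ a ℕ.+ 2 ℕ.* b ℕ.+ (2 ℕ.* x ℕ.+ y)
  regroup = solve-∀

/1≡fromℤ : ∀ i → i / 1 ≡ fromℤ i
/1≡fromℤ (+ n)      = ℚ.normalize-coprime (Coprime.sym (Coprime.1-coprimeTo n))
/1≡fromℤ ℤ.-[1+ n ] = cong -_ (ℚ.normalize-coprime (Coprime.sym (Coprime.1-coprimeTo (suc n))))

fromℤ-homo-+ : ∀ i j → fromℤ i + fromℤ j ≡ fromℤ (i ℤ.+ j)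
fromℤ-homo-+ i j = trans (cong₂ (λ x y → (x ℤ.+ y) / 1) (ℤ.*-identityʳ i) (ℤ.*-identityʳ j))
                         (/1≡fromℤ (i ℤ.+ j))

fromℤ-homo‿- : ∀ i → - fromℤ i ≡ fromℤ (ℤ.- i)
fromℤ-homo‿- ℤ.-[1+ n ] = refl
fromℤ-homo‿- (+ zero)   = refl
fromℤ-homo‿- (+ suc n)  = refl

ℕ→ℚ-homo-+ : ∀ m n → ℕ→ℚ (m ℕ.+ n) ≡ ℕ→ℚ m + ℕ→ℚ n
ℕ→ℚ-homo-+ m n = begin
  ℕ→ℚ (m ℕ.+ n)                ≡⟨ /1≡fromℤ (+ (m ℕ.+ n)) ⟩
  fromℤ (+ m ℤ.+ + n)          ≡⟨ fromℤ-homo-+ (+ m) (+ n) ⟨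
  fromℤ (+ m) + fromℤ (+ n)    ≡⟨ cong₂ _+_ (/1≡fromℤ (+ m)) (/1≡fromℤ (+ n)) ⟨
  ℕ→ℚ m + ℕ→ℚ n                ∎

¼ : ℚ
¼ = + 1 / 4

corr-suc : ∀ ℓ n → corr (suc ℓ) n ≡ -½ * corr ℓ n
corr-suc ℓ zero          = solve 2 (λ A B → (con (- 1ℚ) :* A) :* (con ½ :* B) := con -½ :* (A :* B)) refl
                             ((- 1ℚ) ^ℚ ℓ) (½ ^ℚ suc ℓ)
corr-suc ℓ (suc zero)    = refl
corr-suc ℓ (suc (suc n)) = corr-suc ℓ n

corr-suc-suc : ∀ ℓ n → corr (suc (suc ℓ)) n ≡ ¼ * corr ℓ n
corr-suc-suc ℓ n = begin
  corr (suc (suc ℓ)) n   ≡⟨ corr-suc (suc ℓ) n ⟩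
  -½ * corr (suc ℓ) n    ≡⟨ cong (-½ *_) (corr-suc ℓ n) ⟩
  -½ * (-½ * corr ℓ n)   ≡⟨ solve 1 (λ c → con -½ :* (con -½ :* c) := con ¼ :* c) refl (corr ℓ n) ⟩
  ¼ * corr ℓ n           ∎

sumℚ-cong : ∀ m {f g : ℕ → ℚ} → (∀ i → f i ≡ g i) → sumℚ m f ≡ sumℚ m g
sumℚ-cong zero    f≗g = refl
sumℚ-cong (suc m) f≗g = cong₂ _+_ (sumℚ-cong m f≗g) (f≗g m)

sumℚ-suc : ∀ m (f : ℕ → ℚ) → sumℚ (suc m) f ≡ f 0 + sumℚ m (λ i → f (suc i))
sumℚ-suc zero    f = trans (ℚ.+-identityˡ (f 0)) (sym (ℚ.+-identityʳ (f 0)))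
sumℚ-suc (suc m) f = trans (cong (_+ f (suc m)) (sumℚ-suc m f)) (ℚ.+-assoc (f 0) _ _)

sumℚ-*-distribˡ : ∀ m r (f : ℕ → ℚ) → sumℚ m (λ i → r * f i) ≡ r * sumℚ m f
sumℚ-*-distribˡ zero    r f = sym (ℚ.*-zeroʳ r)
sumℚ-*-distribˡ (suc m) r f =
  trans (cong (_+ r * f m) (sumℚ-*-distribˡ m r f)) (sym (ℚ.*-distribˡ-+ r (sumℚ m f) (f m)))

alternatingSum : ℕ → ℕ → ℚ
alternatingSum ℓ n = sumℚ ℓ (λ i → -½ ^ℚ i * ℕ→ℚ (suc n C (ℓ ℕ.∸ i)))

alternatingSum-suc : ∀ ℓ n → alternatingSum (suc ℓ) n ≡ ℕ→ℚ (suc n C suc ℓ) + -½ * alternatingSum ℓ n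
alternatingSum-suc ℓ n = begin
  alternatingSum (suc ℓ) n
    ≡⟨ sumℚ-suc ℓ _ ⟩
  1ℚ * b + sumℚ ℓ (λ i → (-½ * -½ ^ℚ i) * f i)
    ≡⟨ cong₂ _+_ (ℚ.*-identityˡ b) (sumℚ-cong ℓ (λ i → ℚ.*-assoc -½ (-½ ^ℚ i) (f i))) ⟩
  b + sumℚ ℓ (λ i → -½ * (-½ ^ℚ i * f i))
    ≡⟨ cong (_+_ b) (sumℚ-*-distribˡ ℓ -½ (λ i → -½ ^ℚ i * f i)) ⟩
  b + -½ * alternatingSum ℓ n
    ∎
  where
  b = ℕ→ℚ (suc n C suc ℓ)
  f : ℕ → ℚ
  f i = ℕ→ℚ (suc n C (ℓ ℕ.∸ i))

s-zero≡T+corr : ∀ n → ℕ→ℚ (s 0 n) ≡ T 0 n + corr 0 n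
s-zero≡T+corr zero          = refl
s-zero≡T+corr (suc zero)    = refl
s-zero≡T+corr (suc (suc n)) = begin
  ℕ→ℚ (s 0 (suc (suc n)))                  ≡⟨ cong ℕ→ℚ (s-suc-suc 0 n) ⟩
  ℕ→ℚ (1 ℕ.+ s 0 n)                        ≡⟨ ℕ→ℚ-homo-+ 1 (s 0 n) ⟩
  1ℚ + ℕ→ℚ (s 0 n)                         ≡⟨ cong (_+_ 1ℚ) (s-zero≡T+corr n) ⟩
  1ℚ + (½ * ℕ→ℚ (suc n C 1) + ¼ * 0ℚ + c)  ≡⟨ cong (λ k → 1ℚ + (½ * ℕ→ℚ k + ¼ * 0ℚ + c)) (nC1≡n (suc n)) ⟩
  1ℚ + (½ * x + ¼ * 0ℚ + c)                ≡⟨ solve 2 (λ x c → con 1ℚ :+ (con ½ :* x :+ con ¼ :* con 0ℚ :+ c)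
                                                    := con ½ :* (con (1ℚ + 1ℚ) :+ x) :+ con ¼ :* con 0ℚ :+ c) refl x c ⟩
  ½ * (ℕ→ℚ 2 + x) + ¼ * 0ℚ + c             ≡⟨ cong (λ y → ½ * y + ¼ * 0ℚ + c) (ℕ→ℚ-homo-+ 2 (suc n)) ⟨
  ½ * ℕ→ℚ (suc (suc (suc n))) + ¼ * 0ℚ + c ≡⟨ cong (λ k → ½ * ℕ→ℚ k + ¼ * 0ℚ + c) (nC1≡n (suc (suc (suc n)))) ⟨
  T 0 (suc (suc n)) + corr 0 (suc (suc n)) ∎
  where x = ℕ→ℚ (suc n); c = corr 0 n

s≡T+corr : ∀ ℓ n → ℕ→ℚ (s ℓ n) ≡ T ℓ n + corr ℓ n
s≡T+corr zero    n = s-zero≡T+corr n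
s≡T+corr (suc ℓ) n = begin
  y                                      ≡⟨ solve 2 (λ y x → y := con ½ :* ((y :+ y :+ x) :+ (:- x))) refl y x ⟩
  ½ * ((y + y + x) + - x)                ≡⟨ cong₂ (λ u v → ½ * (u + - v)) 2y+x≡a+b (s≡T+corr ℓ n) ⟩
  ½ * ((a + b) + - (½ * a + ¼ * S + c))  ≡⟨ solve 4 (λ a b S c → con ½ :* ((a :+ b) :+ (:- (con ½ :* a :+ con ¼ :* S :+ c)))
                                              := con ½ :* b :+ con ¼ :* (a :+ con -½ :* S) :+ con -½ :* c) refl a b S c ⟩
  ½ * b + ¼ * (a + -½ * S) + -½ * c      ≡⟨ cong₂ (λ u v → ½ * b + ¼ * u + v) (alternatingSum-suc ℓ n) (corr-suc ℓ n) ⟨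
  T (suc ℓ) n + corr (suc ℓ) n           ∎
  where
  y = ℕ→ℚ (s (suc ℓ) n)
  x = ℕ→ℚ (s ℓ n)
  a = ℕ→ℚ (suc n C suc ℓ)
  b = ℕ→ℚ (suc n C suc (suc ℓ))
  S = alternatingSum ℓ n
  c = corr ℓ n
  2y+x≡a+b : y + y + x ≡ a + b
  2y+x≡a+b = begin
    y + y + x                              ≡⟨ cong (λ z → y + ℕ→ℚ z + x) (ℕ.+-identityʳ (s (suc ℓ) n)) ⟨
    y + ℕ→ℚ (s (suc ℓ) n ℕ.+ 0) + x        ≡⟨ cong (_+ x) (ℕ→ℚ-homo-+ (s (suc ℓ) n) (s (suc ℓ) n ℕ.+ 0)) ⟨
    ℕ→ℚ (2 ℕ.* s (suc ℓ) n) + x            ≡⟨ ℕ→ℚ-homo-+ (2 ℕ.* s (suc ℓ) n) (s ℓ n) ⟨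
    ℕ→ℚ (2 ℕ.* s (suc ℓ) n ℕ.+ s ℓ n)      ≡⟨ cong ℕ→ℚ (2s[ℓ+1]+s[ℓ]≡[n+2]C[ℓ+2] ℓ n) ⟩
    ℕ→ℚ (suc (suc n) C suc (suc ℓ))        ≡⟨ cong ℕ→ℚ (nCk+nC[k+1]≡[n+1]C[k+1] (suc n) (suc ℓ)) ⟨
    ℕ→ℚ (suc n C suc ℓ ℕ.+ suc n C suc (suc ℓ)) ≡⟨ ℕ→ℚ-homo-+ (suc n C suc ℓ) (suc n C suc (suc ℓ)) ⟩
    a + b                                  ∎

/ℕ-unique : ∀ a k d .{{_ : ℕ.NonZero d}} → k ℤ.* + d ℤ.≤ a → a ℤ.< ℤ.suc k ℤ.* + d → a /ℕ d ≡ k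
/ℕ-unique a k d kd≤a a<[k+1]d =
  ℤ.≤-antisym (below ([n/ℕd]*d≤n a d) a<[k+1]d) (below kd≤a (n<s[n/ℕd]*d a d))
  where
  below : ∀ {i j} → i ℤ.* + d ℤ.≤ a → a ℤ.< ℤ.suc j ℤ.* + d → i ℤ.≤ j
  below id≤a a<[j+1]d = ℤ.≮⇒≥ λ j<i → ℤ.<-irrefl refl
    (ℤ.≤-<-trans (ℤ.≤-trans (ℤ.*-monoʳ-≤-nonNeg (+ d) (ℤ.i<j⇒suc[i]≤j j<i)) id≤a) a<[j+1]d)

floor-unique : ∀ k q → fromℤ k ≤ q → q < fromℤ (ℤ.suc k) → floor q ≡ k
floor-unique k (mkℚ a d-1 _) (*≤* kd≤a) (*<* a<[k+1]d) = begin
  a ℤ./ + suc d-1   ≡⟨ div-pos-is-/ℕ a (suc d-1) ⟩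
  a /ℕ suc d-1      ≡⟨ /ℕ-unique a k (suc d-1) (subst (k ℤ.* + suc d-1 ℤ.≤_) (ℤ.*-identityʳ a) kd≤a)
                                                  (subst (ℤ._< _) (ℤ.*-identityʳ a) a<[k+1]d) ⟩
  k                 ∎

infix 4 _∈[0,1⟩
_∈[0,1⟩ : ℚ → Set
x ∈[0,1⟩ = 0ℚ ≤ x × x < 1ℚ

floor-fromℤ-+ : ∀ k e → e ∈[0,1⟩ → floor (fromℤ k + e) ≡ k
floor-fromℤ-+ k e (0≤e , e<1) = floor-unique k (fromℤ k + e)
  (subst (_≤ fromℤ k + e) (ℚ.+-identityʳ (fromℤ k)) (ℚ.+-monoʳ-≤ (fromℤ k) 0≤e))
  (subst (fromℤ k + e <_) (trans (fromℤ-homo-+ k (+ 1)) (cong fromℤ (ℤ.+-comm k (+ 1))))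
    (ℚ.+-monoʳ-< (fromℤ k) e<1))

ceiling≡-floor-neg : ∀ p → ceiling p ≡ ℤ.- floor (- p)
ceiling≡-floor-neg (mkℚ _ _ _) = refl

ceiling-fromℤ-- : ∀ k e → e ∈[0,1⟩ → ceiling (fromℤ k - e) ≡ k
ceiling-fromℤ-- k e e∈ = begin
  ceiling (fromℤ k - e)         ≡⟨ ceiling≡-floor-neg (fromℤ k - e) ⟩
  ℤ.- floor (- (fromℤ k - e))   ≡⟨ cong (λ x → ℤ.- floor x) neg[k-e]≡-k+e ⟩
  ℤ.- floor (fromℤ (ℤ.- k) + e) ≡⟨ cong ℤ.-_ (floor-fromℤ-+ (ℤ.- k) e e∈) ⟩
  ℤ.- (ℤ.- k)                   ≡⟨ ℤ.neg-involutive k ⟩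
  k                             ∎
  where
  neg[k-e]≡-k+e : - (fromℤ k - e) ≡ fromℤ (ℤ.- k) + e
  neg[k-e]≡-k+e = trans (solve 2 (λ K E → :- (K :+ :- E) := :- K :+ E) refl (fromℤ k) e)
                        (cong (_+ e) (fromℤ-homo‿- k))

*-∈[0,1⟩ : ∀ {r x} → r ∈[0,1⟩ → x ∈[0,1⟩ → r * x ∈[0,1⟩
*-∈[0,1⟩ {r} {x} (0≤r , r<1) (0≤x , x<1) =
  subst (_≤ r * x) (ℚ.*-zeroʳ r) (ℚ.*-monoˡ-≤-nonNeg r 0≤x) ,
  ℚ.≤-<-trans (subst (r * x ≤_) (ℚ.*-identityʳ r) (ℚ.*-monoˡ-≤-nonNeg r (ℚ.<⇒≤ x<1))) r<1
  where instance _ = nonNegative 0≤r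

½∈[0,1⟩ : ½ ∈[0,1⟩
½∈[0,1⟩ = from-yes (0ℚ ℚ.≤? ½) , from-yes (½ ℚ.<? 1ℚ)

¼∈[0,1⟩ : ¼ ∈[0,1⟩
¼∈[0,1⟩ = from-yes (0ℚ ℚ.≤? ¼) , from-yes (¼ ℚ.<? 1ℚ)

corr-zero-∈[0,1⟩ : ∀ n → corr 0 n ∈[0,1⟩
corr-zero-∈[0,1⟩ zero          = ½∈[0,1⟩
corr-zero-∈[0,1⟩ (suc zero)    = ℚ.≤-refl , from-yes (0ℚ ℚ.<? 1ℚ)
corr-zero-∈[0,1⟩ (suc (suc n)) = corr-zero-∈[0,1⟩ n

corr-∈[0,1⟩ : ∀ ℓ n → ℓ % 2 ≡ 0 → corr ℓ n ∈[0,1⟩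
corr-∈[0,1⟩ zero          n _ = corr-zero-∈[0,1⟩ n
corr-∈[0,1⟩ (suc (suc ℓ)) n e =
  subst _∈[0,1⟩ (sym (corr-suc-suc ℓ n)) (*-∈[0,1⟩ ¼∈[0,1⟩ (corr-∈[0,1⟩ ℓ n e))

-corr-∈[0,1⟩ : ∀ ℓ n → ℓ % 2 ≡ 1 → - corr ℓ n ∈[0,1⟩
-corr-∈[0,1⟩ (suc zero)    n _ =
  subst _∈[0,1⟩ (sym -corr[1]≡½corr[0]) (*-∈[0,1⟩ ½∈[0,1⟩ (corr-zero-∈[0,1⟩ n))
  where
  -corr[1]≡½corr[0] : - corr 1 n ≡ ½ * corr 0 n
  -corr[1]≡½corr[0] = trans (cong -_ (corr-suc 0 n))
                            (solve 1 (λ c → :- (con -½ :* c) := con ½ :* c) refl (corr 0 n))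
-corr-∈[0,1⟩ (suc (suc ℓ)) n e =
  subst _∈[0,1⟩ (sym (trans (cong -_ (corr-suc-suc ℓ n)) (ℚ.neg-distribʳ-* ¼ (corr ℓ n))))
        (*-∈[0,1⟩ ¼∈[0,1⟩ (-corr-∈[0,1⟩ ℓ n e))

lemma6p3 : (ℓ n : ℕ) →
    (ℕ→ℚ (s ℓ n) ≡ T ℓ n + corr ℓ n)
    × (ℓ % 2 ≡ 0 → ℤ.+ (s ℓ n) ≡ ceiling (T ℓ n))
    × (ℓ % 2 ≡ 1 → ℤ.+ (s ℓ n) ≡ floor (T ℓ n))
lemma6p3 ℓ n = s≡T+corr ℓ n , ceiling-case , floor-case
  where
  T≡s-corr : T ℓ n ≡ fromℤ (+ s ℓ n) - corr ℓ n
  T≡s-corr = begin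
    T ℓ n                               ≡⟨ solve 2 (λ t c → t := (t :+ c) :+ :- c) refl (T ℓ n) (corr ℓ n) ⟩
    (T ℓ n + corr ℓ n) - corr ℓ n       ≡⟨ cong (_- corr ℓ n) (trans (sym (s≡T+corr ℓ n)) (/1≡fromℤ (+ s ℓ n))) ⟩
    fromℤ (+ s ℓ n) - corr ℓ n          ∎
  ceiling-case : ℓ % 2 ≡ 0 → + s ℓ n ≡ ceiling (T ℓ n)
  ceiling-case even = sym (trans (cong ceiling T≡s-corr) (ceiling-fromℤ-- (+ s ℓ n) (corr ℓ n) (corr-∈[0,1⟩ ℓ n even)))
  floor-case : ℓ % 2 ≡ 1 → + s ℓ n ≡ floor (T ℓ n)
  floor-case odd = sym (trans (cong floor T≡s-corr) (floor-fromℤ-+ (+ s ℓ n) (- corr ℓ n) (-corr-∈[0,1⟩ ℓ n odd)))
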